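{- Let $m\ge3$ and let $\frac mn$ be an irreducible proper fraction. Let $r$ be the integer with $0<r<m$ and $r\equiv -2n\pmod m$. (1) If $2n+r\equiv m\pmod{2m}$, then the decomposition \[ \frac mn=\frac{1}{\frac{2n+r+m}{2m}}+\frac{1}{\frac{2n+r+m}{2m}\cdot\frac{2n+r}{m}}+\frac{r}{\frac{2n+r}{m}\,n} \] is faithful if and only if $n>\frac{r(m-1)}2$ and $n\ne\frac{m'(r+m)}{2(m-m')}$ for every integer $m'$ with $\frac m2<m'<m$. (2) If $2n+r\equiv 0\pmod{2m}$, then the decomposition \[ \frac mn=\frac{1}{\frac{2n+r+2m}{2m}}+\frac{1}{\frac{2n+r+2m}{2m}\cdot\frac{2n+r}{2m}}+\frac{r/2}{\frac{2n+r}{2m}\,n} \] is faithful if and only if $n>\frac{r(m-1)}2$ and $n\ne\frac{m'(r+2m)}{2(m-m')}$ for every integer $m'$ with $\frac25m<m'<m$.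
   Context: A decomposition of a positive rational $\frac mn$ is an expression $\frac mn=\sum_{i=1}^k\frac{a_i}{b_i}$ with $a_i$ positive integers and $b_i$ pairwise distinct positive integers. For a positive irreducible fraction $u=\frac mn$, it is faithful if for all integers $0\le x_i\le a_i$, $v=\sum_i\frac{x_i}{b_i}\notin\frac1n\mathbb Z$ unless $v=u$ or $v=0$. -}

module Defs where

open import Data.Nat as ℕ using (ℕ; zero; suc; _+_; _*_; _≤_)
open import Data.Nat.DivMod using (_/_)
open import Data.Integer as ℤ using (ℤ; +_)
open import Data.Rational as ℚ using (ℚ; 0ℚ)
open import Data.List using (List; []; _∷_; map)
open import Data.List.Relation.Binary.Pointwise using (Pointwise)
open import Data.Product using (_×_; _,_; proj₁; ∃-syntax)
open import Data.Sum using (_⊎_)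
open import Relation.Binary.PropositionalEquality using (_≡_)

-- Total natural-number division (a div 0 = 0); only used where the
-- division is exact with a positive divisor.
_div_ : ℕ → ℕ → ℕ
a div zero = 0
a div suc b = a / suc b

-- The rational a / b for b > 0 (0 for b = 0, never used).
frac : ℤ → ℕ → ℚ
frac a zero = 0ℚ
frac a (suc b) = a ℚ./ suc b

-- A decomposition sum_i a_i / b_i is represented by the list of pairs (a_i , b_i).
-- Given choices x_i (one per term) the value  sum_i x_i / b_i :
partialValue : List ℕ → List (ℕ × ℕ) → ℚ
partialValue (x ∷ xs) ((a , b) ∷ ds) = frac (+ x) b ℚ.+ partialValue xs ds
partialValue _ _ = 0ℚ

InOneOverNZ : ℕ → ℚ → Set
InOneOverNZ n v = ∃[ k ] v ≡ frac k n

Faithful : ℕ → ℕ → List (ℕ × ℕ) → Set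
Faithful m n ds =
  (xs : List ℕ) → Pointwise _≤_ xs (map proj₁ ds) →
  InOneOverNZ n (partialValue xs ds) →
  partialValue xs ds ≡ frac (+ m) n ⊎ partialValue xs ds ≡ 0ℚ

decomp1 : ℕ → ℕ → ℕ → List (ℕ × ℕ)
decomp1 m n r =
  let A = (2 * n + r + m) div (2 * m)
      B = (2 * n + r) div m
  in (1 , A) ∷ (1 , A * B) ∷ (r , B * n) ∷ []

decomp2 : ℕ → ℕ → ℕ → List (ℕ × ℕ)
decomp2 m n r =
  let A = (2 * n + r + 2 * m) div (2 * m)
      B = (2 * n + r) div (2 * m)
  in (1 , A) ∷ (1 , A * B) ∷ (r div 2 , B * n) ∷ []

-- Both decompositions have the shape m/n = 1/A + 1/(AB) + c/(Bn) with A ∣ B + 1: in case (1)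
-- A = q + 1, B = 2q + 1, c = r where 2n + r = (2q + 1)m; in case (2) A = q + 1, B = q,
-- c = r/2 where 2n + r = 2qm. A partial sum x₁/A + x₂/(AB) + x₃/(Bn) equals N/(ABn) with
-- N = x₁Bn + x₂n + x₃A, so it lies in (1/n)ℤ iff AB ∣ N. Running through x₁, x₂ ∈ {0, 1}
-- shows that the decomposition is faithful iff c < B and A ∤ n. The first condition is
-- r(m - 1) < 2n. For the second, A·2m = 2n + t (t = r + m resp. r + 2m), so n = m'A exactly
-- when n = m't/(2(m - m')); and since m < n and r < m, the quotient n/A automatically lies
-- in the range of m' allowed by the paper.

module Submission where

open import Defs
open import Data.Nat using (ℕ; zero; suc; _+_; _*_; _∸_; _<_; _≤_; _≤?_; z≤n; s≤s; NonZero; >-nonZero; >-nonZero⁻¹; ≢-nonZero⁻¹)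
open import Data.Nat.Properties
open import Data.Nat.Divisibility using (_∣_; divides; quotient; ∣-refl; ∣-trans; ∣m+n∣m⇒∣n; *-cancelʳ-∣; m∣m*n; n∣m*n; >⇒∤)
open import Data.Nat.DivMod using (m*n/n≡m)
open import Data.Nat.Coprimality using (Coprime)
open import Data.Nat.Tactic.RingSolver using (solve-∀)
open import Data.Integer.Base as ℤ using (+_; -[1+_])
import Data.Integer.Properties as ℤ
open import Data.Rational.Base as ℚ using (0ℚ)
import Data.Rational.Properties as ℚ
import Data.Rational.Unnormalised.Base as ℚᵘ
import Data.Rational.Unnormalised.Properties as ℚᵘ
open import Data.List.Base using (List; []; _∷_)
open import Data.List.Relation.Binary.Pointwise using ([]; _∷_)
open import Data.Product.Base using (_×_; _,_; ∃-syntax)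
open import Data.Product.Function.NonDependent.Propositional using (_×-⇔_)
open import Data.Sum.Base as Sum using (_⊎_; inj₁; inj₂)
open import Function.Base using (_∘_)
open import Function.Bundles using (_⇔_; mk⇔; module Equivalence)
open import Function.Properties.Equivalence using () renaming (trans to ⇔-trans)
open import Relation.Nullary using (¬_; contradiction; yes; no)
open import Relation.Binary.PropositionalEquality

fromℚᵘ-homo-+ : ∀ p q → ℚ.fromℚᵘ p ℚ.+ ℚ.fromℚᵘ q ≡ ℚ.fromℚᵘ (p ℚᵘ.+ q)
fromℚᵘ-homo-+ p q = trans (sym (ℚ.fromℚᵘ-toℚᵘ _)) (ℚ.fromℚᵘ-cong (ℚᵘ.≃-trans
  (ℚ.toℚᵘ-homo-+ (ℚ.fromℚᵘ p) (ℚ.fromℚᵘ q))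
  (ℚᵘ.+-cong (ℚ.toℚᵘ-fromℚᵘ p) (ℚ.toℚᵘ-fromℚᵘ q))))

frac-+ : ∀ a b c d .{{_ : NonZero b}} .{{_ : NonZero d}} →
         frac (+ a) b ℚ.+ frac (+ c) d ≡ frac (+ (a * d + c * b)) (b * d)
frac-+ a b@(suc b-1) c d@(suc d-1) =
  trans (fromℚᵘ-homo-+ (ℚᵘ.mkℚᵘ (+ a) b-1) (ℚᵘ.mkℚᵘ (+ c) d-1))
        (cong (ℚ._/ (b * d)) (begin
          + a ℤ.* + d ℤ.+ + c ℤ.* + b  ≡⟨ cong₂ ℤ._+_ (sym (ℤ.pos-* a d)) (sym (ℤ.pos-* c b)) ⟩
          + (a * d) ℤ.+ + (c * b)      ≡⟨ sym (ℤ.pos-+ (a * d) (c * b)) ⟩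
          + (a * d + c * b)            ∎))
  where open ≡-Reasoning

frac-≡⇒*≡ : ∀ a b c d .{{_ : NonZero b}} .{{_ : NonZero d}} →
            frac (+ a) b ≡ frac (+ c) d → a * d ≡ c * b
frac-≡⇒*≡ a b@(suc b-1) c d@(suc d-1) eq
  with ℚᵘ.*≡* ad≡cb ← ℚ./-injective-≃ (ℚᵘ.mkℚᵘ (+ a) b-1) (ℚᵘ.mkℚᵘ (+ c) d-1) eq
  = ℤ.+-injective (trans (ℤ.pos-* a d) (trans ad≡cb (sym (ℤ.pos-* c b))))

*≡⇒frac-≡ : ∀ a b c d .{{_ : NonZero b}} .{{_ : NonZero d}} →
            a * d ≡ c * b → frac (+ a) b ≡ frac (+ c) d
*≡⇒frac-≡ a b@(suc b-1) c d@(suc d-1) ad≡cb =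
  ℚ.fromℚᵘ-cong {ℚᵘ.mkℚᵘ (+ a) b-1} {ℚᵘ.mkℚᵘ (+ c) d-1}
    (ℚᵘ.*≡* (trans (sym (ℤ.pos-* a d)) (trans (cong +_ ad≡cb) (ℤ.pos-* c b))))

frac≢frac-neg : ∀ a b j d .{{_ : NonZero b}} .{{_ : NonZero d}} → frac (+ a) b ≢ frac -[1+ j ] d
frac≢frac-neg a b@(suc b-1) j d@(suc d-1) eq
  with ℚᵘ.*≡* ad≡-jb ← ℚ./-injective-≃ (ℚᵘ.mkℚᵘ (+ a) b-1) (ℚᵘ.mkℚᵘ -[1+ j ] d-1) eq
  with () ← trans (ℤ.pos-* a d) ad≡-jb

frac-0 : ∀ b .{{_ : NonZero b}} → frac (+ 0) b ≡ 0ℚ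
frac-0 (suc b-1) = ℚ.0/n≡0 (suc b-1)

frac∈1/nℤ⇔∣ : ∀ a d n .{{_ : NonZero d}} .{{_ : NonZero n}} →
              InOneOverNZ n (frac (+ a) (d * n)) ⇔ d ∣ a
frac∈1/nℤ⇔∣ a d@(suc _) n@(suc _) = mk⇔ to from
  where
  to : InOneOverNZ n (frac (+ a) (d * n)) → d ∣ a
  to (-[1+ j ] , eq) = contradiction eq (frac≢frac-neg a (d * n) j n)
  to (+ k , eq) = divides k (*-cancelʳ-≡ a (k * d) n
    (trans (frac-≡⇒*≡ a (d * n) k n eq) (sym (*-assoc k d n))))
  from : d ∣ a → InOneOverNZ n (frac (+ a) (d * n))
  from (divides k a≡kd) = + k , *≡⇒frac-≡ a (d * n) k n
    (trans (cong (_* n) a≡kd) (*-assoc k d n))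

frac≡frac⇔ : ∀ a m d n .{{_ : NonZero d}} .{{_ : NonZero n}} →
             frac (+ a) (d * n) ≡ frac (+ m) n ⇔ a ≡ m * d
frac≡frac⇔ a m d@(suc _) n@(suc _) = mk⇔
  (λ eq → *-cancelʳ-≡ a (m * d) n (trans (frac-≡⇒*≡ a (d * n) m n eq) (sym (*-assoc m d n))))
  (λ a≡md → *≡⇒frac-≡ a (d * n) m n (trans (cong (_* n) a≡md) (*-assoc m d n)))

frac≡0⇔ : ∀ a b .{{_ : NonZero b}} → frac (+ a) b ≡ 0ℚ ⇔ a ≡ 0
frac≡0⇔ a b = mk⇔
  (λ eq → trans (sym (*-identityʳ a)) (frac-≡⇒*≡ a b 0 1 (trans eq (sym (frac-0 1)))))
  (λ { refl → frac-0 b })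

threeTermDecomp : ℕ → ℕ → ℕ → ℕ → List (ℕ × ℕ)
threeTermDecomp A B c n = (1 , A) ∷ (1 , A * B) ∷ (c , B * n) ∷ []

threeTermNumerator : ℕ → ℕ → ℕ → ℕ → ℕ → ℕ → ℕ
threeTermNumerator A B n x₁ x₂ x₃ = x₁ * (B * n) + x₂ * n + x₃ * A

partialValue-threeTermDecomp :
  ∀ A B c n .{{_ : NonZero A}} .{{_ : NonZero B}} .{{_ : NonZero n}} x₁ x₂ x₃ →
  partialValue (x₁ ∷ x₂ ∷ x₃ ∷ []) (threeTermDecomp A B c n)
    ≡ frac (+ threeTermNumerator A B n x₁ x₂ x₃) (A * B * n)
partialValue-threeTermDecomp A@(suc _) B@(suc _) c n@(suc _) x₁ x₂ x₃ = begin
  frac (+ x₁) A ℚ.+ (frac (+ x₂) (A * B) ℚ.+ (frac (+ x₃) (B * n) ℚ.+ 0ℚ))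
    ≡⟨ cong (λ v → frac (+ x₁) A ℚ.+ (frac (+ x₂) (A * B) ℚ.+ v)) (ℚ.+-identityʳ _) ⟩
  frac (+ x₁) A ℚ.+ (frac (+ x₂) (A * B) ℚ.+ frac (+ x₃) (B * n))
    ≡⟨ cong (frac (+ x₁) A ℚ.+_) (frac-+ x₂ (A * B) x₃ (B * n)) ⟩
  frac (+ x₁) A ℚ.+ frac (+ (x₂ * (B * n) + x₃ * (A * B))) (A * B * (B * n))
    ≡⟨ frac-+ x₁ A (x₂ * (B * n) + x₃ * (A * B)) (A * B * (B * n)) ⟩
  frac (+ (x₁ * (A * B * (B * n)) + (x₂ * (B * n) + x₃ * (A * B)) * A)) (A * (A * B * (B * n)))
    ≡⟨ *≡⇒frac-≡ (x₁ * (A * B * (B * n)) + (x₂ * (B * n) + x₃ * (A * B)) * A) (A * (A * B * (B * n)))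
                  (threeTermNumerator A B n x₁ x₂ x₃) (A * B * n)
                   (cross-multiplied A B n x₁ x₂ x₃) ⟩
  frac (+ threeTermNumerator A B n x₁ x₂ x₃) (A * B * n) ∎
  where
  open ≡-Reasoning
  cross-multiplied : ∀ A B n x₁ x₂ x₃ →
    (x₁ * (A * B * (B * n)) + (x₂ * (B * n) + x₃ * (A * B)) * A) * (A * B * n)
      ≡ (x₁ * (B * n) + x₂ * n + x₃ * A) * (A * (A * B * (B * n)))
  cross-multiplied = solve-∀

DivisibilityFaithful : ℕ → ℕ → ℕ → ℕ → ℕ → Set
DivisibilityFaithful m A B c n = ∀ x₁ x₂ x₃ → x₁ ≤ 1 → x₂ ≤ 1 → x₃ ≤ c →
  A * B ∣ threeTermNumerator A B n x₁ x₂ x₃ →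
  threeTermNumerator A B n x₁ x₂ x₃ ≡ m * (A * B) ⊎ threeTermNumerator A B n x₁ x₂ x₃ ≡ 0

faithful⇔divisibilityFaithful :
  ∀ m A B c n .{{_ : NonZero A}} .{{_ : NonZero B}} .{{_ : NonZero n}} →
  Faithful m n (threeTermDecomp A B c n) ⇔ DivisibilityFaithful m A B c n
faithful⇔divisibilityFaithful m A@(suc _) B@(suc _) c n@(suc _) = mk⇔ faithful⇒ ⇒faithful
  where
  open Equivalence
  N : ℕ → ℕ → ℕ → ℕ
  N = threeTermNumerator A B n
  value≡ : ∀ x₁ x₂ x₃ → partialValue (x₁ ∷ x₂ ∷ x₃ ∷ []) (threeTermDecomp A B c n) ≡ frac (+ N x₁ x₂ x₃) (A * B * n)
  value≡ = partialValue-threeTermDecomp A B c n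

  faithful⇒ : Faithful m n (threeTermDecomp A B c n) → DivisibilityFaithful m A B c n
  faithful⇒ F x₁ x₂ x₃ x₁≤1 x₂≤1 x₃≤c AB∣N =
    Sum.map (to (frac≡frac⇔ (N x₁ x₂ x₃) m (A * B) n) ∘ trans (sym (value≡ x₁ x₂ x₃)))
            (to (frac≡0⇔ (N x₁ x₂ x₃) (A * B * n)) ∘ trans (sym (value≡ x₁ x₂ x₃)))
            (F (x₁ ∷ x₂ ∷ x₃ ∷ []) (x₁≤1 ∷ x₂≤1 ∷ x₃≤c ∷ [])
               (subst (InOneOverNZ n) (sym (value≡ x₁ x₂ x₃)) (from (frac∈1/nℤ⇔∣ (N x₁ x₂ x₃) (A * B) n) AB∣N)))

  ⇒faithful : DivisibilityFaithful m A B c n → Faithful m n (threeTermDecomp A B c n)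
  ⇒faithful G (x₁ ∷ x₂ ∷ x₃ ∷ []) (x₁≤1 ∷ x₂≤1 ∷ x₃≤c ∷ []) value∈1/nℤ =
    Sum.map (trans (value≡ x₁ x₂ x₃) ∘ from (frac≡frac⇔ (N x₁ x₂ x₃) m (A * B) n))
            (trans (value≡ x₁ x₂ x₃) ∘ from (frac≡0⇔ (N x₁ x₂ x₃) (A * B * n)))
            (G x₁ x₂ x₃ x₁≤1 x₂≤1 x₃≤c
               (to (frac∈1/nℤ⇔∣ (N x₁ x₂ x₃) (A * B) n) (subst (InOneOverNZ n) (value≡ x₁ x₂ x₃) value∈1/nℤ)))

m*n∣o*m∧o<n⇒o≡0 : ∀ {m n o} .{{_ : NonZero m}} → m * n ∣ o * m → o < n → o ≡ 0
m*n∣o*m∧o<n⇒o≡0 {o = zero}  _      _   = refl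
m*n∣o*m∧o<n⇒o≡0 {m} {n} {o@(suc _)} mn∣om o<n =
  contradiction (*-cancelʳ-∣ m (subst (_∣ o * m) (*-comm m n) mn∣om)) (>⇒∤ o<n)

module _ {m A B c n : ℕ} .{{_ : NonZero A}} .{{_ : NonZero B}} .{{_ : NonZero n}}
         (1<m : 1 < m) (A∣1+B : A ∣ suc B) (identity : B * n + n + c * A ≡ m * (A * B)) where

  private
    instance
      A*B≢0 : NonZero (A * B)
      A*B≢0 = m*n≢0 A B

    N = threeTermNumerator A B n

    N-1-0 : ∀ x₃ → N 1 0 x₃ ≡ x₃ * A + B * n
    N-1-0 x₃ = trans (cong (_+ x₃ * A) (trans (+-identityʳ _) (+-identityʳ (B * n)))) (+-comm (B * n) (x₃ * A))

    N-0-1 : ∀ x₃ → N 0 1 x₃ ≡ x₃ * A + n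
    N-0-1 x₃ = trans (cong (_+ x₃ * A) (+-identityʳ n)) (+-comm n (x₃ * A))

    A*B∣⇒A∣ : ∀ {k} → A * B ∣ k → A ∣ k
    A*B∣⇒A∣ = ∣-trans (m∣m*n B)

    A∣B*n⇒A∣n : A ∣ B * n → A ∣ n
    A∣B*n⇒A∣n A∣Bn = ∣m+n∣m⇒∣n (subst (A ∣_) (+-comm n (B * n)) (∣-trans A∣1+B (m∣m*n n))) A∣Bn

  divisibilityFaithful⇒ : DivisibilityFaithful m A B c n → c < B × ¬ A ∣ n
  divisibilityFaithful⇒ F = c<B , A∤n
    where
    -- Witnesses: x = (0, 0, B) has value 1/n, and x = (1, 0, 0) has value 1/A.
    B*A≡1*[A*B] : B * A ≡ 1 * (A * B)
    B*A≡1*[A*B] = trans (*-comm B A) (sym (*-identityˡ (A * B)))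

    c<B : c < B
    c<B = ≰⇒> λ B≤c → Sum.[
      (λ BA≡mAB → <⇒≢ 1<m (*-cancelʳ-≡ 1 m (A * B) (trans (sym B*A≡1*[A*B]) BA≡mAB))) ,
      ≢-nonZero⁻¹ (B * A) {{m*n≢0 B A}} ]′
      (F 0 0 B z≤n z≤n B≤c (divides 1 B*A≡1*[A*B]))

    B*n≢m*[A*B] : B * n ≢ m * (A * B)
    B*n≢m*[A*B] Bn≡mAB = ≢-nonZero⁻¹ n (m+n≡0⇒m≡0 n (sym (+-cancelˡ-≡ (B * n) 0 (n + c * A) (begin
      B * n + 0          ≡⟨ +-identityʳ (B * n) ⟩
      B * n              ≡⟨ trans Bn≡mAB (sym identity) ⟩
      B * n + n + c * A  ≡⟨ +-assoc (B * n) n (c * A) ⟩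
      B * n + (n + c * A) ∎))))
      where open ≡-Reasoning

    A∤n : ¬ A ∣ n
    A∤n (divides k n≡kA) =
      Sum.[ B*n≢m*[A*B] ∘ trans (sym (N-1-0 0)) , ≢-nonZero⁻¹ (B * n) {{m*n≢0 B n}} ∘ trans (sym (N-1-0 0)) ]′
        (F 1 0 0 (s≤s z≤n) z≤n z≤n (divides k (trans (N-1-0 0) B*n≡k*[A*B])))
      where
      B*n≡k*[A*B] : B * n ≡ k * (A * B)
      B*n≡k*[A*B] = trans (cong (B *_) n≡kA) (trans (*-comm B (k * A)) (*-assoc k A B))

  ⇒divisibilityFaithful : c < B × ¬ A ∣ n → DivisibilityFaithful m A B c n
  ⇒divisibilityFaithful (c<B , A∤n) _ _ x₃ z≤n z≤n x₃≤c AB∣N =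
    inj₂ (cong (_* A) (m*n∣o*m∧o<n⇒o≡0 AB∣N (≤-<-trans x₃≤c c<B)))
  ⇒divisibilityFaithful (c<B , A∤n) _ _ x₃ z≤n (s≤s z≤n) _ AB∣N =
    contradiction (∣m+n∣m⇒∣n (subst (A ∣_) (N-0-1 x₃) (A*B∣⇒A∣ AB∣N)) (n∣m*n x₃)) A∤n
  ⇒divisibilityFaithful (c<B , A∤n) _ _ x₃ (s≤s z≤n) z≤n _ AB∣N =
    contradiction (A∣B*n⇒A∣n (∣m+n∣m⇒∣n (subst (A ∣_) (N-1-0 x₃) (A*B∣⇒A∣ AB∣N)) (n∣m*n x₃))) A∤n
  ⇒divisibilityFaithful (c<B , A∤n) _ _ x₃ (s≤s z≤n) (s≤s z≤n) x₃≤c AB∣N = inj₁ (begin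
    N 1 1 x₃                 ≡⟨ sym (+-identityʳ _) ⟩
    N 1 1 x₃ + 0 * A         ≡⟨ cong (λ d → N 1 1 x₃ + d * A) (sym c∸x₃≡0) ⟩
    N 1 1 x₃ + (c ∸ x₃) * A  ≡⟨ completed ⟩
    m * (A * B)              ∎)
    where
    open ≡-Reasoning
    regroup : ∀ Bn n x d A → 1 * Bn + 1 * n + x * A + d * A ≡ Bn + n + (x + d) * A
    regroup = solve-∀
    completed : N 1 1 x₃ + (c ∸ x₃) * A ≡ m * (A * B)
    completed = begin
      N 1 1 x₃ + (c ∸ x₃) * A         ≡⟨ regroup (B * n) n x₃ (c ∸ x₃) A ⟩
      B * n + n + (x₃ + (c ∸ x₃)) * A ≡⟨ cong (λ y → B * n + n + y * A) (m+[n∸m]≡n x₃≤c) ⟩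
      B * n + n + c * A               ≡⟨ identity ⟩
      m * (A * B)                     ∎
    c∸x₃≡0 : c ∸ x₃ ≡ 0
    c∸x₃≡0 = m*n∣o*m∧o<n⇒o≡0 (∣m+n∣m⇒∣n (divides m completed) AB∣N) (≤-<-trans (m∸n≤m c x₃) c<B)

  divisibilityFaithful⇔ : DivisibilityFaithful m A B c n ⇔ (c < B × ¬ A ∣ n)
  divisibilityFaithful⇔ = mk⇔ divisibilityFaithful⇒ ⇒divisibilityFaithful

<⇔*pred< : ∀ {c B X} m .{{_ : NonZero m}} → B * m ≡ X + c → c < B ⇔ c * (m ∸ 1) < X
<⇔*pred< {c} {B} {X} m@(suc m-1) B*m≡X+c = mk⇔
  (λ c<B → +-cancelʳ-< c (c * m-1) X (subst₂ _<_ c*m≡c*m-1+c B*m≡X+c (*-monoˡ-< m c<B)))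
  (λ lt → *-cancelʳ-< m c B (subst₂ _<_ (sym c*m≡c*m-1+c) (sym B*m≡X+c) (+-monoˡ-< c lt)))
  where
  c*m≡c*m-1+c : c * m ≡ c * m-1 + c
  c*m≡c*m-1+c = trans (*-suc c m-1) (+-comm c (c * m-1))

Exceptional : ℕ → ℕ → ℕ → ℕ → Set
Exceptional n t m m' = frac (+ n) 1 ≡ frac (+ (m' * t)) (2 * (m ∸ m'))

module _ {n m A t : ℕ} (A*2m≡2n+t : A * (2 * m) ≡ 2 * n + t) where

  private
    2*[m∸k]≢0 : ∀ {k} → k < m → NonZero (2 * (m ∸ k))
    2*[m∸k]≢0 {k} k<m = m*n≢0 2 (m ∸ k) {{_}} {{>-nonZero (m<n⇒0<n∸m k<m)}}

  exceptional⇒≡*A : ∀ {m'} → m' < m → Exceptional n t m m' → n ≡ m' * A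
  exceptional⇒≡*A {m'} m'<m exc =
    *-cancelʳ-≡ n (m' * A) (2 * m) {{m*n≢0 2 m {{_}} {{>-nonZero (≤-<-trans z≤n m'<m)}}}} (begin
    n * (2 * m)              ≡⟨ cong (λ x → n * (2 * x)) (sym m'+E≡m) ⟩
    n * (2 * (m' + E))       ≡⟨ expand n m' E ⟩
    2 * n * m' + n * (2 * E) ≡⟨ cong (_+_ (2 * n * m')) cross ⟩
    2 * n * m' + m' * t * 1  ≡⟨ collect n m' t ⟩
    m' * (2 * n + t)         ≡⟨ cong (m' *_) (sym A*2m≡2n+t) ⟩
    m' * (A * (2 * m))       ≡⟨ sym (*-assoc m' A (2 * m)) ⟩
    m' * A * (2 * m)         ∎)
    where
    open ≡-Reasoning
    E = m ∸ m'
    m'+E≡m : m' + E ≡ m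
    m'+E≡m = m+[n∸m]≡n (<⇒≤ m'<m)
    cross : n * (2 * E) ≡ m' * t * 1
    cross = frac-≡⇒*≡ n 1 (m' * t) (2 * E) {{_}} {{2*[m∸k]≢0 m'<m}} exc
    expand : ∀ n m' E → n * (2 * (m' + E)) ≡ 2 * n * m' + n * (2 * E)
    expand = solve-∀
    collect : ∀ n m' t → 2 * n * m' + m' * t * 1 ≡ m' * (2 * n + t)
    collect = solve-∀

  module _ {k : ℕ} (n≡k*A : n ≡ k * A) where

    quotient<m : 0 < t → k < m
    quotient<m 0<t = ≰⇒> λ m≤k → <⇒≱ (m<m+n (2 * n) 0<t) (begin
      2 * n + t    ≡⟨ sym A*2m≡2n+t ⟩
      A * (2 * m)  ≤⟨ *-monoʳ-≤ A (*-monoʳ-≤ 2 m≤k) ⟩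
      A * (2 * k)  ≡⟨ trans (*-comm A (2 * k)) (*-assoc 2 k A) ⟩
      2 * (k * A)  ≡⟨ cong (2 *_) (sym n≡k*A) ⟩
      2 * n        ∎)
      where open ≤-Reasoning

    t≡2*A*[m∸k] : k ≤ m → t ≡ 2 * A * (m ∸ k)
    t≡2*A*[m∸k] k≤m = +-cancelˡ-≡ (2 * (k * A)) t (2 * A * (m ∸ k)) (begin
      2 * (k * A) + t              ≡⟨ cong (λ x → 2 * x + t) (sym n≡k*A) ⟩
      2 * n + t                    ≡⟨ sym A*2m≡2n+t ⟩
      A * (2 * m)                  ≡⟨ cong (λ x → A * (2 * x)) (sym (m+[n∸m]≡n k≤m)) ⟩
      A * (2 * (k + (m ∸ k)))      ≡⟨ expand A k (m ∸ k) ⟩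
      2 * (k * A) + 2 * A * (m ∸ k) ∎)
      where
      open ≡-Reasoning
      expand : ∀ A k E → A * (2 * (k + E)) ≡ 2 * (k * A) + 2 * A * E
      expand = solve-∀

    quotient-exceptional : k < m → Exceptional n t m k
    quotient-exceptional k<m = *≡⇒frac-≡ n 1 (k * t) (2 * (m ∸ k)) {{_}} {{2*[m∸k]≢0 k<m}} (begin
      n * (2 * (m ∸ k))          ≡⟨ cong (_* (2 * (m ∸ k))) n≡k*A ⟩
      k * A * (2 * (m ∸ k))      ≡⟨ regroup k A (m ∸ k) ⟩
      k * (2 * A * (m ∸ k)) * 1  ≡⟨ cong (λ x → k * x * 1) (sym (t≡2*A*[m∸k] (<⇒≤ k<m))) ⟩
      k * t * 1                  ∎)
      where
      open ≡-Reasoning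
      regroup : ∀ k A E → k * A * (2 * E) ≡ k * (2 * A * E) * 1
      regroup = solve-∀

  ¬∣⇔noExceptional : 0 < t → (InRange : ℕ → Set) →
    (∀ {k} → n ≡ k * A → k < m → t ≡ 2 * A * (m ∸ k) → InRange k) →
    (¬ A ∣ n) ⇔ (∀ m' → InRange m' → m' < m → ¬ Exceptional n t m m')
  ¬∣⇔noExceptional 0<t InRange inRange = mk⇔
    (λ A∤n m' _ m'<m exc → A∤n (divides m' (exceptional⇒≡*A m'<m exc)))
    (λ noExc (divides k n≡kA) → let k<m = quotient<m n≡kA 0<t in
      noExc k (inRange n≡kA k<m (t≡2*A*[m∸k] n≡kA (<⇒≤ k<m))) k<m (quotient-exceptional n≡kA k<m))

-- If the quotient k = n/A were too small, A ≤ 1 (resp. A ≤ 2) would give n ≤ m, and a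
-- larger A would make r + m (resp. r + 2m) = 2A(m - k) too large for r < m.
module _ {m n r A k : ℕ} (m<n : m < n) (r<m : r < m) (n≡k*A : n ≡ k * A) (k<m : k < m) where

  private
    E = m ∸ k
    k+E≡m : k + E ≡ m
    k+E≡m = m+[n∸m]≡n (<⇒≤ k<m)

  m<2*quotient : r + m ≡ 2 * A * (m ∸ k) → m < 2 * k
  m<2*quotient r+m≡2AE = ≰⇒> 2k≰m
    where
    open ≤-Reasoning
    2k≰m : ¬ 2 * k ≤ m
    2k≰m 2k≤m with A ≤? 1
    ... | yes A≤1 = <⇒≱ m<n (begin
      n      ≡⟨ n≡k*A ⟩
      k * A  ≤⟨ *-monoʳ-≤ k A≤1 ⟩
      k * 1  ≡⟨ *-identityʳ k ⟩
      k      ≤⟨ m≤m+n k (k + 0) ⟩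
      2 * k  ≤⟨ 2k≤m ⟩
      m      ∎)
    ... | no A≰1 = <⇒≱ r<m (+-cancelʳ-≤ m m r (begin
      m + m          ≤⟨ +-mono-≤ m≤2E m≤2E ⟩
      2 * E + 2 * E  ≡⟨ double E ⟩
      2 * 2 * E      ≤⟨ *-monoˡ-≤ E (*-monoʳ-≤ 2 (≰⇒> A≰1)) ⟩
      2 * A * E      ≡⟨ sym r+m≡2AE ⟩
      r + m          ∎))
      where
      double : ∀ E → 2 * E + 2 * E ≡ 2 * 2 * E
      double = solve-∀
      twice : ∀ k E → (k + E) + (k + E) ≡ 2 * k + 2 * E
      twice = solve-∀
      m≤2E : m ≤ 2 * E
      m≤2E = +-cancelˡ-≤ m m (2 * E) (begin
        m + m              ≡⟨ cong₂ _+_ (sym k+E≡m) (sym k+E≡m) ⟩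
        (k + E) + (k + E)  ≡⟨ twice k E ⟩
        2 * k + 2 * E      ≤⟨ +-monoˡ-≤ (2 * E) 2k≤m ⟩
        m + 2 * E          ∎)

  2*m<5*quotient : r + 2 * m ≡ 2 * A * (m ∸ k) → 2 * m < 5 * k
  2*m<5*quotient r+2m≡2AE = ≰⇒> 5k≰2m
    where
    open ≤-Reasoning
    5k≰2m : ¬ 5 * k ≤ 2 * m
    5k≰2m 5k≤2m with A ≤? 2
    ... | yes A≤2 = <⇒≱ m<n (*-cancelˡ-≤ 5 (begin
      5 * n        ≡⟨ cong (5 *_) n≡k*A ⟩
      5 * (k * A)  ≤⟨ *-monoʳ-≤ 5 (*-monoʳ-≤ k A≤2) ⟩
      5 * (k * 2)  ≡⟨ regroup k ⟩
      2 * (5 * k)  ≤⟨ *-monoʳ-≤ 2 5k≤2m ⟩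
      2 * (2 * m)  ≡⟨ regroup′ m ⟩
      4 * m        ≤⟨ *-monoˡ-≤ m (n≤1+n 4) ⟩
      5 * m        ∎))
      where
      regroup : ∀ k → 5 * (k * 2) ≡ 2 * (5 * k)
      regroup = solve-∀
      regroup′ : ∀ m → 2 * (2 * m) ≡ 4 * m
      regroup′ = solve-∀
    ... | no A≰2 = <⇒≱ (begin-strict
      6 * E          ≤⟨ *-monoˡ-≤ E (*-monoʳ-≤ 2 (≰⇒> A≰2)) ⟩
      2 * A * E      ≡⟨ sym r+2m≡2AE ⟩
      r + 2 * m      <⟨ +-monoˡ-< (2 * m) r<m ⟩
      m + 2 * m      ≡⟨ cong (λ x → x + 2 * x) (sym k+E≡m) ⟩
      (k + E) + 2 * (k + E) ≡⟨ expand k E ⟩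
      3 * k + 3 * E  ≤⟨ +-monoˡ-≤ (3 * E) 3k≤2E ⟩
      2 * E + 3 * E  ≡⟨ collect E ⟩
      5 * E          ∎) (*-monoˡ-≤ E (n≤1+n 5))
      where
      expand : ∀ k E → (k + E) + 2 * (k + E) ≡ 3 * k + 3 * E
      expand = solve-∀
      collect : ∀ E → 2 * E + 3 * E ≡ 5 * E
      collect = solve-∀
      split5 : ∀ k → 5 * k ≡ 2 * k + 3 * k
      split5 = solve-∀
      split2 : ∀ k E → 2 * (k + E) ≡ 2 * k + 2 * E
      split2 = solve-∀
      3k≤2E : 3 * k ≤ 2 * E
      3k≤2E = +-cancelˡ-≤ (2 * k) (3 * k) (2 * E) (begin
        2 * k + 3 * k  ≡⟨ sym (split5 k) ⟩
        5 * k          ≤⟨ 5k≤2m ⟩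
        2 * m          ≡⟨ cong (2 *_) (sym k+E≡m) ⟩
        2 * (k + E)    ≡⟨ split2 k E ⟩
        2 * k + 2 * E  ∎)

div-exact : ∀ {a} q b .{{_ : NonZero b}} → a ≡ q * b → a div b ≡ q
div-exact q (suc b-1) refl = m*n/n≡m q (suc b-1)

A*[B*m]≡m*[A*B] : ∀ A B m → A * (B * m) ≡ m * (A * B)
A*[B*m]≡m*[A*B] = solve-∀

faithful₁⇔ : ∀ m n r q .{{_ : NonZero m}} .{{_ : NonZero n}} →
  1 < m → m < n → r < m → 2 * n + r ≡ q * (2 * m) + m →
  Faithful m n (decomp1 m n r) ⇔
    (r * (m ∸ 1) < 2 * n × (∀ m' → m < 2 * m' → m' < m → ¬ Exceptional n (r + m) m m'))
faithful₁⇔ m@(suc _) n@(suc _) r q 1<m m<n r<m 2n+r≡ =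
  ⇔-trans (subst (λ ds → Faithful m n ds ⇔ DivisibilityFaithful m A B r n) (sym decomp1≡)
                 (faithful⇔divisibilityFaithful m A B r n))
  (⇔-trans (divisibilityFaithful⇔ 1<m A∣1+B identity)
           (<⇔*pred< m B*m≡2n+r ×-⇔ ¬∣⇔noExceptional A*2m≡2n+[r+m] (≤-trans (>-nonZero⁻¹ m) (m≤n+m m r)) _
              (λ n≡kA k<m → m<2*quotient m<n r<m n≡kA k<m)))
  where
  A = suc q
  B = suc (2 * q)
  odd : ∀ q m → suc (2 * q) * m ≡ q * (2 * m) + m
  odd = solve-∀
  B*m≡2n+r : B * m ≡ 2 * n + r
  B*m≡2n+r = trans (odd q m) (sym 2n+r≡)
  succ : ∀ q m → suc q * (2 * m) ≡ q * (2 * m) + m + m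
  succ = solve-∀
  A*2m≡2n+r+m : A * (2 * m) ≡ 2 * n + r + m
  A*2m≡2n+r+m = trans (succ q m) (cong (_+ m) (sym 2n+r≡))
  A*2m≡2n+[r+m] : A * (2 * m) ≡ 2 * n + (r + m)
  A*2m≡2n+[r+m] = trans A*2m≡2n+r+m (+-assoc (2 * n) r m)
  decomp1≡ : decomp1 m n r ≡ threeTermDecomp A B r n
  decomp1≡ = cong₂ (λ X Y → (1 , X) ∷ (1 , X * Y) ∷ (r , Y * n) ∷ [])
    (div-exact A (2 * m) (sym A*2m≡2n+r+m)) (div-exact B m (sym B*m≡2n+r))
  A∣1+B : A ∣ suc B
  A∣1+B = divides 2 (even q)
    where
    even : ∀ q → suc (suc (2 * q)) ≡ 2 * suc q
    even = solve-∀
  factor : ∀ q n r → suc (2 * q) * n + n + r * suc q ≡ suc q * (2 * n + r)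
  factor = solve-∀
  identity : B * n + n + r * A ≡ m * (A * B)
  identity = trans (factor q n r) (trans (cong (A *_) (sym B*m≡2n+r)) (A*[B*m]≡m*[A*B] A B m))

faithful₂⇔ : ∀ m n r q .{{_ : NonZero m}} .{{_ : NonZero n}} →
  1 < m → m < n → r < m → 2 * n + r ≡ q * (2 * m) →
  Faithful m n (decomp2 m n r) ⇔
    (r * (m ∸ 1) < 2 * n × (∀ m' → 2 * m < 5 * m' → m' < m → ¬ Exceptional n (r + 2 * m) m m'))
faithful₂⇔ m@(suc _) n@(suc _) r zero    _   _   _   ()
faithful₂⇔ m@(suc _) n@(suc _) r q@(suc _) 1<m m<n r<m 2n+r≡ =
  ⇔-trans (subst (λ ds → Faithful m n ds ⇔ DivisibilityFaithful m A B s n) (sym decomp2≡)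
                 (faithful⇔divisibilityFaithful m A B s n))
  (⇔-trans (divisibilityFaithful⇔ 1<m ∣-refl identity)
           (⇔-trans (<⇔*pred< m B*m≡n+s) halve ×-⇔ ¬∣⇔noExceptional A*2m≡2n+[r+2m] 0<r+2m _
              (λ n≡kA k<m → 2*m<5*quotient m<n r<m n≡kA k<m)))
  where
  A = suc q
  B = q
  2n+r≡[q*m]*2 : 2 * n + r ≡ q * m * 2
  2n+r≡[q*m]*2 = trans 2n+r≡ (trans (*-comm q (2 * m)) (trans (*-assoc 2 m q) (trans (*-comm 2 (m * q)) (cong (_* 2) (*-comm m q)))))
  2∣r : 2 ∣ r
  2∣r = ∣m+n∣m⇒∣n (divides (q * m) 2n+r≡[q*m]*2) (divides n (*-comm 2 n))
  s = quotient 2∣r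
  r≡s*2 : r ≡ s * 2
  r≡s*2 = _∣_.equality 2∣r
  B*m≡n+s : B * m ≡ n + s
  B*m≡n+s = *-cancelʳ-≡ (q * m) (n + s) 2 (begin
    q * m * 2      ≡⟨ sym 2n+r≡[q*m]*2 ⟩
    2 * n + r      ≡⟨ cong (_+_ (2 * n)) r≡s*2 ⟩
    2 * n + s * 2  ≡⟨ cong (_+ s * 2) (*-comm 2 n) ⟩
    n * 2 + s * 2  ≡⟨ *-distribʳ-+ 2 n s ⟨
    (n + s) * 2    ∎)
    where open ≡-Reasoning
  halve : s * (m ∸ 1) < n ⇔ r * (m ∸ 1) < 2 * n
  halve = subst (λ x → s * (m ∸ 1) < n ⇔ x < 2 * n) (sym r*[m∸1]≡2*[s*[m∸1]])
    (mk⇔ (*-monoʳ-< 2) (*-cancelˡ-< 2 (s * (m ∸ 1)) n))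
    where
    r*[m∸1]≡2*[s*[m∸1]] : r * (m ∸ 1) ≡ 2 * (s * (m ∸ 1))
    r*[m∸1]≡2*[s*[m∸1]] = trans (cong (_* (m ∸ 1)) (trans r≡s*2 (*-comm s 2))) (*-assoc 2 s (m ∸ 1))
  succ : ∀ q m → suc q * (2 * m) ≡ q * (2 * m) + 2 * m
  succ = solve-∀
  A*2m≡2n+r+2m : A * (2 * m) ≡ 2 * n + r + 2 * m
  A*2m≡2n+r+2m = trans (succ q m) (cong (_+ 2 * m) (sym 2n+r≡))
  A*2m≡2n+[r+2m] : A * (2 * m) ≡ 2 * n + (r + 2 * m)
  A*2m≡2n+[r+2m] = trans A*2m≡2n+r+2m (+-assoc (2 * n) r (2 * m))
  0<r+2m : 0 < r + 2 * m
  0<r+2m = ≤-trans (>-nonZero⁻¹ (2 * m)) (m≤n+m (2 * m) r)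
  decomp2≡ : decomp2 m n r ≡ threeTermDecomp A B s n
  decomp2≡ = trans
    (cong₂ (λ X Y → (1 , X) ∷ (1 , X * Y) ∷ (r div 2 , Y * n) ∷ [])
      (div-exact A (2 * m) (sym A*2m≡2n+r+2m)) (div-exact B (2 * m) 2n+r≡))
    (cong (λ c → (1 , A) ∷ (1 , A * B) ∷ (c , B * n) ∷ []) (div-exact s 2 r≡s*2))
  factor : ∀ q n s → q * n + n + s * suc q ≡ suc q * (n + s)
  factor = solve-∀
  identity : B * n + n + s * A ≡ m * (A * B)
  identity = trans (factor q n s) (trans (cong (A *_) (sym B*m≡n+s)) (A*[B*m]≡m*[A*B] A B m))

-- Coprimality of m and n, 0 < r and m ∣ r + 2n are not needed: each case hypothesis
-- already fixes the shape of 2n + r, and faithfulness is decided without them.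
proposition5p2 :
    (m n r : ℕ) → 3 ≤ m → Coprime m n → m < n →
    0 < r → r < m → m ∣ (r + 2 * n) →
    ((∃[ q ] 2 * n + r ≡ q * (2 * m) + m) →
      (Faithful m n (decomp1 m n r) ⇔
        ((r * (m ∸ 1) < 2 * n) ×
         ((m' : ℕ) → m < 2 * m' → m' < m →
           frac (+ n) 1 ≢ frac (+ (m' * (r + m))) (2 * (m ∸ m'))))))
    ×
    ((∃[ q ] 2 * n + r ≡ q * (2 * m)) →
      (Faithful m n (decomp2 m n r) ⇔
        ((r * (m ∸ 1) < 2 * n) ×
         ((m' : ℕ) → 2 * m < 5 * m' → m' < m →
           frac (+ n) 1 ≢ frac (+ (m' * (r + 2 * m))) (2 * (m ∸ m'))))))
proposition5p2 m n r 3≤m _ m<n _ r<m _ =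
  (λ (q , 2n+r≡) → faithful₁⇔ m n r q 1<m m<n r<m 2n+r≡) ,
  (λ (q , 2n+r≡) → faithful₂⇔ m n r q 1<m m<n r<m 2n+r≡)
  where
  1<m : 1 < m
  1<m = ≤-trans (s≤s (s≤s z≤n)) 3≤m
  instance
    m≢0 : NonZero m
    m≢0 = >-nonZero (≤-trans (s≤s z≤n) (<⇒≤ 1<m))
    n≢0 : NonZero n
    n≢0 = >-nonZero (≤-<-trans z≤n m<n)
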